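{- Let $p_0,\dots,p_d\in\mathbb{R}^d$ satisfy $\sum_{i=0}^d p_i=0$ with every $d$ of them linearly independent, let $D=\{0,1,\dots,d\}$, and for $i\in D$ let $R_i=\{\lambda p_i:\lambda>0\}$. Let $r\geq 2$, let $X$ be a set consisting of $r-1$ distinct points on each ray $R_i$ ($i\in D$), and let $X=C_1\cup\dots\cup C_r$ be a partition of $X$ into $r$ disjoint sets. Then for every nonempty subset $J\subset D$ there is a part $C_i$ with $|C_i\cap R(J)|\leq\left\lfloor\frac{r-1}{r}|J|\right\rfloor$.
   Context: For $J\subset D$, $R(J)=\bigcup_{i\in J}R_i$. -}

module Defs where

open import Data.Nat using (ℕ; suc; _∸_)
open import Data.Fin using (Fin)
open import Data.Fin.Properties using () renaming (_≟_ to _≟ᶠ_)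
open import Data.Fin.Subset using (Subset)
open import Data.Fin.Subset.Properties using (_∈?_)
open import Data.List using (List; length; filter; cartesianProduct; allFin)
open import Data.Product using (_×_; _,_)
open import Relation.Nullary.Decidable using (_×-dec_)

-- A point of X is identified by (i , k): the k-th of the r-1 points on ray R_i.
-- (The rays are pairwise disjoint, since the p_i are nonzero and pairwise
--  non-parallel, so this identification is injective.)
Point : ℕ → ℕ → Set
Point d r = Fin (suc d) × Fin (r ∸ 1)

allPoints : (d r : ℕ) → List (Point d r)
allPoints d r = cartesianProduct (allFin (suc d)) (allFin (r ∸ 1))

-- |C_c ∩ R(J)|, where the partition X = C_1 ∪ ... ∪ C_r is given by a map
-- col : X → Fin r  (C_c = col⁻¹(c)), and R(J) = ⋃_{i∈J} R_i.
partInRays : {d r : ℕ} → (col : Point d r → Fin r) → Subset (suc d) → Fin r → ℕ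
partInRays {d} {r} col J c =
  length (filter (λ { (i , k) → (i ∈? J) ×-dec (col (i , k) ≟ᶠ c) }) (allPoints d r))

{-# OPTIONS --safe #-}
module Submission where

-- Each ray R_i carries r - 1 points of X, so R(J) contains (r - 1)|J| points in total,
-- distributed among the r parts C_c. If every part had more than
-- ⌊(r - 1)|J| / r⌋ of them, the parts would together contain at least
-- r (⌊(r - 1)|J| / r⌋ + 1) > (r - 1)|J| points: some part gets at most the average.

open import Defs
import Algebra.Properties.CommutativeMonoid.Sum as Sum
open import Data.Nat using (ℕ; suc; _+_; _*_; _∸_; _≤_; _<_; NonZero)
open import Data.Nat.Properties
  using ( +-0-commutativeMonoid; _≤?_; ≰⇒>; ≤-<-trans; +-monoˡ-≤; +-monoˡ-<; +-cancelˡ-<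
        ; +-identityʳ; *-comm; *-suc; *-distribʳ-+; module ≤-Reasoning)
open Sum +-0-commutativeMonoid using (sum-syntax; sum-cong-≗; sum-replicate-zero; ∑-distrib-+)
open import Data.Nat.DivMod using (_/_; _%_; m≡m%n+[m/n]*n; m%n<n)
open import Data.Fin using (Fin; zero; suc)
open import Data.Fin.Properties using (_≟_)
open import Data.Fin.Subset using (Subset; Nonempty; ∣_∣; inside; outside; _∈_)
open import Data.Fin.Subset.Properties using (_∈?_)
open import Data.List using (List; []; _∷_; length; filter; map; _++_; tabulate; allFin; cartesianProduct)
open import Data.List.Properties
  using (filter-++; filter-all; filter-none; length-++; length-map; length-tabulate; map-tabulate)
open import Data.List.Relation.Unary.All using (universal)
open import Data.List.Relation.Unary.All.Properties using (map⁺)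
open import Data.Vec using ([]; _∷_)
open import Data.Bool using (true; false; if_then_else_)
open import Data.Product using (∃; _,_; proj₁)
open import Function using (_∘_)
open import Relation.Nullary using (Dec; yes; no; does)
open import Relation.Nullary.Decidable using (_×-dec_)
open import Relation.Unary using (Pred; Decidable)
open import Relation.Binary.PropositionalEquality using (_≡_; refl; sym; trans; cong; cong₂; subst; module ≡-Reasoning)

indicator : ∀ {a} {A : Set a} → Dec A → ℕ
indicator a? = if does a? then 1 else 0

-- Both clauses hold by computation: zero ≟ suc c is a no, and suc a ≟ suc c is a map′ of a ≟ c.
∑-indicator-≟ : ∀ {n} (a : Fin n) → ∑[ c < n ] indicator (a ≟ c) ≡ 1
∑-indicator-≟ {suc n} zero = cong suc (sum-replicate-zero n)
∑-indicator-≟ (suc a) = ∑-indicator-≟ a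

module _ {a p} {A : Set a} {P : Pred A p} (P? : Decidable P) where

  length-filter-∷ : ∀ x xs → length (filter P? (x ∷ xs)) ≡ indicator (P? x) + length (filter P? xs)
  length-filter-∷ x xs with does (P? x)
  ... | true = refl
  ... | false = refl

  filter-×-dec : ∀ {q} {Q : Pred A q} (Q? : Decidable Q) xs →
    filter (λ x → P? x ×-dec Q? x) xs ≡ filter Q? (filter P? xs)
  filter-×-dec Q? [] = refl
  filter-×-dec Q? (x ∷ xs) with does (P? x)
  ... | false = filter-×-dec Q? xs
  ... | true with does (Q? x)
  ...   | true = cong (x ∷_) (filter-×-dec Q? xs)
  ...   | false = filter-×-dec Q? xs

∑-length-filter-≟ : ∀ {a n} {A : Set a} (f : A → Fin n) xs →
  ∑[ c < n ] length (filter (λ x → f x ≟ c) xs) ≡ length xs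
∑-length-filter-≟ {n = n} f [] = sum-replicate-zero n
∑-length-filter-≟ {n = n} f (x ∷ xs) = begin
  ∑[ c < n ] length (filter (λ y → f y ≟ c) (x ∷ xs))
    ≡⟨ sum-cong-≗ (λ c → length-filter-∷ (λ y → f y ≟ c) x xs) ⟩
  ∑[ c < n ] (indicator (f x ≟ c) + length (filter (λ y → f y ≟ c) xs))
    ≡⟨ ∑-distrib-+ (λ c → indicator (f x ≟ c)) _ ⟩
  ∑[ c < n ] indicator (f x ≟ c) + ∑[ c < n ] length (filter (λ y → f y ≟ c) xs)
    ≡⟨ cong₂ _+_ (∑-indicator-≟ (f x)) (∑-length-filter-≟ f xs) ⟩
  suc (length xs) ∎
  where open ≡-Reasoning

length-filter-proj₁-cartesianProduct :
  ∀ {a b p} {A : Set a} {B : Set b} {P : Pred A p} (P? : Decidable P) xs (ys : List B) →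
  length (filter (P? ∘ proj₁) (cartesianProduct xs ys)) ≡ length (filter P? xs) * length ys
length-filter-proj₁-cartesianProduct P? [] ys = refl
length-filter-proj₁-cartesianProduct P? (x ∷ xs) ys = begin
  length (filter (P? ∘ proj₁) (map (x ,_) ys ++ cartesianProduct xs ys))
    ≡⟨ cong length (filter-++ (P? ∘ proj₁) (map (x ,_) ys) _) ⟩
  length (filter (P? ∘ proj₁) (map (x ,_) ys) ++ filter (P? ∘ proj₁) (cartesianProduct xs ys))
    ≡⟨ length-++ (filter (P? ∘ proj₁) (map (x ,_) ys)) ⟩
  length (filter (P? ∘ proj₁) (map (x ,_) ys)) + length (filter (P? ∘ proj₁) (cartesianProduct xs ys))
    ≡⟨ cong₂ _+_ length-filter-row (length-filter-proj₁-cartesianProduct P? xs ys) ⟩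
  indicator (P? x) * length ys + length (filter P? xs) * length ys
    ≡⟨ sym (*-distribʳ-+ (length ys) (indicator (P? x)) _) ⟩
  (indicator (P? x) + length (filter P? xs)) * length ys
    ≡⟨ cong (_* length ys) (sym (length-filter-∷ P? x xs)) ⟩
  length (filter P? (x ∷ xs)) * length ys ∎
  where
  open ≡-Reasoning

  length-filter-row : length (filter (P? ∘ proj₁) (map (x ,_) ys)) ≡ indicator (P? x) * length ys
  length-filter-row with P? x
  ... | yes px = begin
    length (filter (P? ∘ proj₁) (map (x ,_) ys))
      ≡⟨ cong length (filter-all (P? ∘ proj₁) (map⁺ (universal (λ _ → px) ys))) ⟩
    length (map (x ,_) ys)
      ≡⟨ length-map (x ,_) ys ⟩
    length ys
      ≡⟨ sym (+-identityʳ (length ys)) ⟩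
    1 * length ys ∎
  ... | no ¬px = cong length (filter-none (P? ∘ proj₁) (map⁺ (universal (λ _ → ¬px) ys)))

length-filter-∈?-map-suc : ∀ {n} s (p : Subset n) is →
  length (filter (_∈? s ∷ p) (map suc is)) ≡ length (filter (_∈? p) is)
length-filter-∈?-map-suc s p [] = refl
length-filter-∈?-map-suc s p (i ∷ is) = begin
  length (filter (_∈? s ∷ p) (suc i ∷ map suc is))
    ≡⟨ length-filter-∷ (_∈? s ∷ p) (suc i) (map suc is) ⟩
  indicator (i ∈? p) + length (filter (_∈? s ∷ p) (map suc is))
    ≡⟨ cong (indicator (i ∈? p) +_) (length-filter-∈?-map-suc s p is) ⟩
  indicator (i ∈? p) + length (filter (_∈? p) is)
    ≡⟨ sym (length-filter-∷ (_∈? p) i is) ⟩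
  length (filter (_∈? p) (i ∷ is)) ∎
  where open ≡-Reasoning

length-filter-∈?-allFin : ∀ {n} (p : Subset n) → length (filter (_∈? p) (allFin n)) ≡ ∣ p ∣
length-filter-∈?-allFin [] = refl
length-filter-∈?-allFin {suc n} (s ∷ p) = begin
  length (filter (_∈? s ∷ p) (zero ∷ tabulate suc))
    ≡⟨ length-filter-∷ (_∈? s ∷ p) zero (tabulate suc) ⟩
  indicator (zero ∈? s ∷ p) + length (filter (_∈? s ∷ p) (tabulate suc))
    ≡⟨ cong (λ is → indicator (zero ∈? s ∷ p) + length (filter (_∈? s ∷ p) is))
            (sym (map-tabulate (λ i → i) suc)) ⟩
  indicator (zero ∈? s ∷ p) + length (filter (_∈? s ∷ p) (map suc (allFin n)))
    ≡⟨ cong (indicator (zero ∈? s ∷ p) +_)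
            (trans (length-filter-∈?-map-suc s p (allFin n)) (length-filter-∈?-allFin p)) ⟩
  indicator (zero ∈? s ∷ p) + ∣ p ∣
    ≡⟨ indicator-head s ⟩
  ∣ s ∷ p ∣ ∎
  where
  open ≡-Reasoning

  indicator-head : ∀ s → indicator (zero ∈? s ∷ p) + ∣ p ∣ ≡ ∣ s ∷ p ∣
  indicator-head inside = refl
  indicator-head outside = refl

∑-pigeonhole : ∀ n (f : Fin n → ℕ) m → ∑[ i < n ] f i < n * suc m → ∃ λ i → f i ≤ m
∑-pigeonhole (suc n) f m ∑f<n*[1+m] with f zero ≤? m
... | yes f₀≤m = zero , f₀≤m
... | no f₀≰m =
  let i , fi≤m = ∑-pigeonhole n (f ∘ suc) m
        (+-cancelˡ-< (suc m) _ _ (≤-<-trans (+-monoˡ-≤ _ (≰⇒> f₀≰m)) ∑f<n*[1+m]))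
  in suc i , fi≤m

m<n*[1+m/n] : ∀ m n .{{_ : NonZero n}} → m < n * suc (m / n)
m<n*[1+m/n] m n = begin-strict
  m                       ≡⟨ m≡m%n+[m/n]*n m n ⟩
  m % n + (m / n) * n     <⟨ +-monoˡ-< _ (m%n<n m n) ⟩
  n + (m / n) * n         ≡⟨ cong (n +_) (*-comm (m / n) n) ⟩
  n + n * (m / n)         ≡⟨ sym (*-suc n (m / n)) ⟩
  n * suc (m / n)         ∎
  where open ≤-Reasoning

∑-partInRays : ∀ {d r} (col : Point d r → Fin r) (J : Subset (suc d)) →
  ∑[ c < r ] partInRays col J c ≡ (r ∸ 1) * ∣ J ∣
∑-partInRays {d} {r} col J = begin
  ∑[ c < r ] partInRays col J c
    ≡⟨ sum-cong-≗ (λ c → cong length (filter-×-dec inRays (λ x → col x ≟ c) (allPoints d r))) ⟩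
  ∑[ c < r ] length (filter (λ x → col x ≟ c) (filter inRays (allPoints d r)))
    ≡⟨ ∑-length-filter-≟ col (filter inRays (allPoints d r)) ⟩
  length (filter inRays (allPoints d r))
    ≡⟨ length-filter-proj₁-cartesianProduct (_∈? J) (allFin (suc d)) (allFin (r ∸ 1)) ⟩
  length (filter (_∈? J) (allFin (suc d))) * length (allFin (r ∸ 1))
    ≡⟨ cong₂ _*_ (length-filter-∈?-allFin J) (length-tabulate (λ k → k)) ⟩
  ∣ J ∣ * (r ∸ 1)
    ≡⟨ *-comm ∣ J ∣ (r ∸ 1) ⟩
  (r ∸ 1) * ∣ J ∣ ∎
  where
  open ≡-Reasoning

  inRays : Decidable {A = Point d r} (λ x → proj₁ x ∈ J)
  inRays = (_∈? J) ∘ proj₁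

proposition6 : (d : ℕ) → 1 ≤ d → (r : ℕ) → 2 ≤ r → .{{_ : NonZero r}} →
    (col : Point d r → Fin r) →
    (J : Subset (suc d)) → Nonempty J →
    ∃ λ (c : Fin r) → partInRays col J c ≤ ((r ∸ 1) * ∣ J ∣) / r
proposition6 d _ r _ col J _ =
  -- The counting argument needs none of the hypotheses 1 ≤ d, 2 ≤ r and J ≠ ∅.
  ∑-pigeonhole r (partInRays col J) (N / r)
    (subst (_< r * suc (N / r)) (sym (∑-partInRays col J)) (m<n*[1+m/n] N r))
  where
  N : ℕ
  N = (r ∸ 1) * ∣ J ∣
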